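{- Let $K$ be a field of characteristic $0$ and let $a,b,c\in K$. Let $(a_n)_{n\ge0}$ be the sequence whose generating function is the revert transform of $\frac{1+ax}{1+bx+cx^2}$, and let $b_n=\sum_{k=0}^n\binom{n}{k}a_k$. Let $e$ be an element of some extension field $L\supseteq K$ with $e^2=(b+1)^2-4(c+a)$, and put $$\tilde q=\frac{b+1-e}{2},\qquad \tilde r=-e,\qquad \tilde s=-\frac{2a-b-1-e}{2}.$$ Then the generating function $\sum_{n\ge0}b_nx^n$ equals the Thron-type continued fraction $$\cfrac{1}{1-\tilde qx-\cfrac{\tilde sx}{1-\tilde rx-\cfrac{\tilde sx}{1-\tilde rx-\cdots}}}.$$
   Context: For $h(x)\in K[[x]]$ with $h(0)\ne0$, the revert transform of $h$ is $\frac1x$ times the compositional inverse of $xh(x)$. The Thron-type continued fraction $\cfrac{1}{1-\tilde qx-\cfrac{\tilde sx}{1-\tilde rx-\cfrac{\tilde sx}{1-\tilde rx-\cdots}}}$ denotes the formal power series $\frac{1}{1-\tilde qx-\tilde sxU(x)}$, where $U(x)\in L[[x]]$ is the unique power series satisfying $U(x)=\frac{1}{1-\tilde rx-\tilde sxU(x)}$. -}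

module Defs where

open import Level using (Level; suc; _⊔_)
open import Algebra.Bundles using (CommutativeRing; Semiring)
import Algebra.Definitions.RawSemiring as RawSemiringDefs
open import Data.Nat as ℕ using (ℕ; zero) renaming (suc to 1+)
open import Data.Nat.Combinatorics using (_C_)
open import Data.Product using (∃; _×_; _,_)
open import Relation.Nullary using (¬_)

record Field (c ℓ : Level) : Set (suc (c ⊔ ℓ)) where
  field
    commutativeRing : CommutativeRing c ℓ
  open CommutativeRing commutativeRing public
  field
    1≉0     : ¬ (1# ≈ 0#)
    inverse : ∀ x → ¬ (x ≈ 0#) → ∃ λ y → x * y ≈ 1#

module PowerSeries {c ℓ : Level} (F : Field c ℓ) where
  open Field F
  open RawSemiringDefs (Semiring.rawSemiring semiring) using () renaming (_×_ to _·ℕ_)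

  -- n ·ℕ x = x + ... + x (n times); characteristic 0 means n·1 ≠ 0 for n ≥ 1
  CharZero : Set ℓ
  CharZero = ∀ n → ¬ ((1+ n) ·ℕ 1# ≈ 0#)

  Series : Set c
  Series = ℕ → Carrier

  infix 4 _≋_
  _≋_ : Series → Series → Set ℓ
  f ≋ g = ∀ n → f n ≈ g n

  Σ< : ℕ → (ℕ → Carrier) → Carrier
  Σ< zero   f = 0#
  Σ< (1+ n) f = Σ< n f + f n

  const : Carrier → Series
  const k zero   = k
  const k (1+ n) = 0#

  𝟙 : Series
  𝟙 = const 1#

  xmul : Series → Series
  xmul f zero   = 0#
  xmul f (1+ n) = f n

  X : Series
  X = xmul 𝟙

  infixl 6 _⊕_ _⊖_
  _⊕_ : Series → Series → Series
  (f ⊕ g) n = f n + g n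

  _⊖_ : Series → Series → Series
  (f ⊖ g) n = f n - g n

  infixl 7 _⊙_
  _⊙_ : Carrier → Series → Series
  (k ⊙ f) n = k * f n

  infixl 7 _⊛_
  _⊛_ : Series → Series → Series
  (f ⊛ g) n = Σ< (1+ n) (λ k → f k * g (n ℕ.∸ k))

  pow : Series → ℕ → Series
  pow f zero   = 𝟙
  pow f (1+ k) = f ⊛ pow f k

  -- composition g(f(x)), meaningful when f(0) = 0:
  -- [x^n] g(f) = Σ_{k ≤ n} g_k [x^n] f^k
  compose : Series → Series → Series
  compose g f n = Σ< (1+ n) (λ k → g k * pow f k n)

  IsCompInverse : Series → Series → Set ℓ
  IsCompInverse G F = F 0 ≈ 0# × G 0 ≈ 0# × compose G F ≋ X × compose F G ≋ X

  IsRevertTransform : Series → Series → Set ℓ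
  IsRevertTransform h A = ¬ (h 0 ≈ 0#) × IsCompInverse (xmul h) (xmul A)

  IsThronTail : Carrier → Carrier → Series → Set ℓ
  IsThronTail r s U = U ⊛ (𝟙 ⊖ r ⊙ X ⊖ s ⊙ xmul U) ≋ 𝟙

  -- G equals the Thron-type continued fraction 1/(1 - q x - s x U(x)),
  -- with U the (unique) series satisfying U = 1/(1 - r x - s x U)
  IsThronCF : Carrier → Carrier → Carrier → Series → Set (c ⊔ ℓ)
  IsThronCF q r s G =
    ∃ λ U → IsThronTail r s U × G ⊛ (𝟙 ⊖ q ⊙ X ⊖ s ⊙ xmul U) ≋ 𝟙

  binomialTransform : Series → Series
  binomialTransform A n = Σ< (1+ n) (λ k → (n C k) ·ℕ A k)

{-# OPTIONS --safe #-}
module Submission where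

-- Put Y = xA. As Y is the compositional inverse of x h(x), substituting Y into
-- h (1 + b x + c x²) = 1 + a x gives x (1 + b Y + c Y²) = Y (1 + a Y), that is
-- A = 1 + x (b A − a A² + c x A²). The binomial transform is B(x) = A(x/(1−x))/(1−x), so
-- B·W_B = 1 for W_B = 1 − (b+1) x + a x B − (a+c) x² B, and W_B is a root of
-- Z² = (1 − (b+1) x) Z + a x − (a+c) x². The denominator W = 1 − q̃x − s̃xU of the continued
-- fraction satisfies Z² = (1 − (2q̃ − r̃) x) Z + (q̃ − r̃ − s̃) x − q̃(q̃ − r̃) x², which is the same
-- equation by the choice of q̃, r̃, s̃ and e² = (b+1)² − 4(c+a). This equation has only one root
-- with constant term 1, so W = W_B and B·W = 1.

open import Defs
open import Level using (Level)
open import Algebra.Bundles using (CommutativeRing)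
import Algebra.Properties.AbelianGroup as AbelianGroupProperties
import Algebra.Properties.CommutativeMonoid.Mult as CommutativeMonoidMult
import Algebra.Properties.CommutativeSemigroup as CommutativeSemigroupProperties
import Algebra.Properties.Group as GroupProperties
import Algebra.Properties.Ring as RingProperties
import Algebra.Properties.Semiring.Mult as SemiringMult
import Algebra.Properties.Semiring.Mult.TCOptimised as TCOptimisedMult
import Algebra.Solver.Ring
import Algebra.Solver.Ring.AlmostCommutativeRing as ACR
open import Data.Integer as ℤ using (ℤ; +_; -[1+_]; +0; +[1+_]; sign; ∣_∣; _◃_)
import Data.Integer.Properties as ℤ
open import Data.Maybe using (Maybe; just; nothing)
open import Data.Nat as ℕ using (ℕ; zero; suc; _<_; _≤_; s≤s)
open import Data.Nat.Combinatorics using (_C_; nCk+nC[k+1]≡[n+1]C[k+1]; k>n⇒nCk≡0)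
open import Data.Nat.Induction using (<-rec)
import Data.Nat.Properties as ℕ
open import Data.Product using (∃; _,_; proj₁; proj₂; map₂)
open import Data.Sign as Sign using (Sign)
open import Data.Sum using (inj₁; inj₂)
open import Relation.Nullary using (¬_; yes; no)
import Relation.Binary.PropositionalEquality as ≡
import Relation.Binary.Reasoning.Setoid as SetoidReasoning

module IntegerRingSolver {c ℓ : Level} (R : CommutativeRing c ℓ) where
  open CommutativeRing R
  open RingProperties ring using (-1*x≈-x)
  open GroupProperties +-group using (⁻¹-involutive; ε⁻¹≈ε)
  open AbelianGroupProperties +-abelianGroup using (⁻¹-∙-comm)
  open CommutativeSemigroupProperties *-commutativeSemigroup using () renaming (interchange to *-interchange)
  open CommutativeSemigroupProperties +-commutativeSemigroup using () renaming (interchange to +-interchange)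
  open TCOptimisedMult semiring using (_×_; ×-homo-+; ×1-homo-*; 1+×)
  open SetoidReasoning setoid

  fromℤ : ℤ → Carrier
  fromℤ (+ n)    = n × 1#
  fromℤ -[1+ n ] = - (suc n × 1#)

  private
    x-y≈[z+x]-[z+y] : ∀ x y z → x - y ≈ (z + x) - (z + y)
    x-y≈[z+x]-[z+y] x y z = sym (begin
      (z + x) - (z + y)     ≈⟨ +-congˡ (sym (⁻¹-∙-comm z y)) ⟩
      (z + x) + (- z - y)   ≈⟨ +-interchange z x (- z) (- y) ⟩
      (z - z) + (x - y)     ≈⟨ +-congʳ (-‿inverseʳ z) ⟩
      0# + (x - y)          ≈⟨ +-identityˡ _ ⟩
      x - y                 ∎)

  fromℤ-⊖ : ∀ m n → fromℤ (m ℤ.⊖ n) ≈ m × 1# - n × 1#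
  fromℤ-⊖ m       zero    = sym (trans (+-congˡ ε⁻¹≈ε) (+-identityʳ _))
  fromℤ-⊖ zero    (suc n) = sym (+-identityˡ _)
  fromℤ-⊖ (suc m) (suc n) rewrite ℤ.[1+m]⊖[1+n]≡m⊖n m n = begin
    fromℤ (m ℤ.⊖ n)                ≈⟨ fromℤ-⊖ m n ⟩
    m × 1# - n × 1#                ≈⟨ x-y≈[z+x]-[z+y] _ _ 1# ⟩
    (1# + m × 1#) - (1# + n × 1#)  ≈⟨ +-cong (1+× m 1#) (-‿cong (1+× n 1#)) ⟨
    suc m × 1# - suc n × 1#        ∎

  fromℤ-+ : ∀ i j → fromℤ (i ℤ.+ j) ≈ fromℤ i + fromℤ j
  fromℤ-+ (+ m)    (+ n)    = ×-homo-+ 1# m n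
  fromℤ-+ (+ m)    -[1+ n ] = fromℤ-⊖ m (suc n)
  fromℤ-+ -[1+ m ] (+ n)    = trans (fromℤ-⊖ n (suc m)) (+-comm _ _)
  fromℤ-+ -[1+ m ] -[1+ n ] = begin
    - (suc (suc (m ℕ.+ n)) × 1#)     ≡⟨ ≡.cong (λ k → - (suc k × 1#)) (ℕ.+-suc m n) ⟨
    - ((suc m ℕ.+ suc n) × 1#)       ≈⟨ -‿cong (×-homo-+ 1# (suc m) (suc n)) ⟩
    - (suc m × 1# + suc n × 1#)      ≈⟨ ⁻¹-∙-comm _ _ ⟨
    - (suc m × 1#) - (suc n × 1#)    ∎

  fromℤ-neg : ∀ i → fromℤ (ℤ.- i) ≈ - fromℤ i
  fromℤ-neg -[1+ n ] = sym (⁻¹-involutive _)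
  fromℤ-neg +0       = sym ε⁻¹≈ε
  fromℤ-neg +[1+ n ] = refl

  fromSign : Sign → Carrier
  fromSign Sign.+ = 1#
  fromSign Sign.- = - 1#

  fromSign-* : ∀ s t → fromSign (s Sign.* t) ≈ fromSign s * fromSign t
  fromSign-* Sign.+ t      = sym (*-identityˡ _)
  fromSign-* Sign.- Sign.+ = sym (*-identityʳ _)
  fromSign-* Sign.- Sign.- = sym (trans (-1*x≈-x _) (⁻¹-involutive _))

  fromℤ-◃ : ∀ s n → fromℤ (s ◃ n) ≈ fromSign s * (n × 1#)
  fromℤ-◃ s       zero    = sym (zeroʳ _)
  fromℤ-◃ Sign.+ (suc n) = sym (*-identityˡ _)
  fromℤ-◃ Sign.- (suc n) = sym (-1*x≈-x _)

  fromℤ-sign-abs : ∀ i → fromℤ i ≈ fromSign (sign i) * (∣ i ∣ × 1#)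
  fromℤ-sign-abs (+ n)    = sym (*-identityˡ _)
  fromℤ-sign-abs -[1+ n ] = sym (-1*x≈-x _)

  fromℤ-* : ∀ i j → fromℤ (i ℤ.* j) ≈ fromℤ i * fromℤ j
  fromℤ-* i j = begin
    fromℤ (i ℤ.* j)
      ≈⟨ fromℤ-◃ (sign i Sign.* sign j) (∣ i ∣ ℕ.* ∣ j ∣) ⟩
    fromSign (sign i Sign.* sign j) * ((∣ i ∣ ℕ.* ∣ j ∣) × 1#)
      ≈⟨ *-cong (fromSign-* (sign i) (sign j)) (×1-homo-* ∣ i ∣ ∣ j ∣) ⟩
    (fromSign (sign i) * fromSign (sign j)) * ((∣ i ∣ × 1#) * (∣ j ∣ × 1#))
      ≈⟨ *-interchange _ _ _ _ ⟩
    (fromSign (sign i) * (∣ i ∣ × 1#)) * (fromSign (sign j) * (∣ j ∣ × 1#))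
      ≈⟨ *-cong (fromℤ-sign-abs i) (fromℤ-sign-abs j) ⟨
    fromℤ i * fromℤ j ∎

  fromℤ-morphism : ℤ.+-*-rawRing ACR.-Raw-AlmostCommutative⟶ ACR.fromCommutativeRing R
  fromℤ-morphism = record
    { ⟦_⟧ = fromℤ ; +-homo = fromℤ-+ ; *-homo = fromℤ-* ; -‿homo = fromℤ-neg
    ; 0-homo = refl ; 1-homo = refl }

  fromℤ-≟ : ∀ i j → Maybe (fromℤ i ≈ fromℤ j)
  fromℤ-≟ i j with i ℤ.≟ j
  ... | yes ≡.refl = just refl
  ... | no _       = nothing

  open Algebra.Solver.Ring ℤ.+-*-rawRing (ACR.fromCommutativeRing R) fromℤ-morphism fromℤ-≟ public
    using (solve; _:=_; _:+_; _:*_; :-_; _:-_; con)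

module FormalPowerSeries {c ℓ : Level} (F : Field c ℓ) where
  open Field F
  open PowerSeries F
  module ≈-Reasoning = SetoidReasoning setoid
  open RingProperties ring using (-‿distribˡ-*)
  open GroupProperties +-group using (ε⁻¹≈ε)
  open SemiringMult semiring using (_×_; ×-homo-+; ×-comm-*; ×-congʳ)
  open CommutativeMonoidMult +-commutativeMonoid using (×-distrib-+)
  open CommutativeSemigroupProperties +-commutativeSemigroup using ()
    renaming (interchange to +-interchange; x∙yz≈y∙xz to x+[y+z]≈y+[x+z])
  open CommutativeSemigroupProperties *-commutativeSemigroup using ()
    renaming (x∙yz≈y∙xz to x*[y*z]≈y*[x*z])

  Σ<-cong : ∀ n {f g : ℕ → Carrier} → (∀ k → k < n → f k ≈ g k) → Σ< n f ≈ Σ< n g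
  Σ<-cong zero    f≈g = refl
  Σ<-cong (suc n) f≈g = +-cong (Σ<-cong n (λ k k<n → f≈g k (ℕ.m<n⇒m<1+n k<n))) (f≈g n ℕ.≤-refl)

  Σ<-congᵖ : ∀ n {f g : ℕ → Carrier} → (∀ k → f k ≈ g k) → Σ< n f ≈ Σ< n g
  Σ<-congᵖ n f≈g = Σ<-cong n (λ k _ → f≈g k)

  Σ<-+ : ∀ n (f g : ℕ → Carrier) → Σ< n (λ k → f k + g k) ≈ Σ< n f + Σ< n g
  Σ<-+ zero    f g = sym (+-identityʳ 0#)
  Σ<-+ (suc n) f g = trans (+-congʳ (Σ<-+ n f g)) (+-interchange _ _ _ _)

  Σ<-*ˡ : ∀ n x (f : ℕ → Carrier) → Σ< n (λ k → x * f k) ≈ x * Σ< n f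
  Σ<-*ˡ zero    x f = sym (zeroʳ x)
  Σ<-*ˡ (suc n) x f = trans (+-congʳ (Σ<-*ˡ n x f)) (sym (distribˡ _ _ _))

  Σ<-zero : ∀ n {f : ℕ → Carrier} → (∀ k → k < n → f k ≈ 0#) → Σ< n f ≈ 0#
  Σ<-zero zero    f≈0 = refl
  Σ<-zero (suc n) f≈0 =
    trans (+-cong (Σ<-zero n (λ k k<n → f≈0 k (ℕ.m<n⇒m<1+n k<n))) (f≈0 n ℕ.≤-refl)) (+-identityʳ 0#)

  Σ<-suc : ∀ n (f : ℕ → Carrier) → Σ< (suc n) f ≈ f 0 + Σ< n (λ k → f (suc k))
  Σ<-suc zero    f = trans (+-identityˡ _) (sym (+-identityʳ _))
  Σ<-suc (suc n) f = trans (+-congʳ (Σ<-suc n f)) (+-assoc _ _ _)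

  Σ<-swap : ∀ m n (f : ℕ → ℕ → Carrier) → Σ< m (λ i → Σ< n (f i)) ≈ Σ< n (λ j → Σ< m (λ i → f i j))
  Σ<-swap zero    n f = sym (Σ<-zero n (λ _ _ → refl))
  Σ<-swap (suc m) n f = trans (+-congʳ (Σ<-swap m n f)) (sym (Σ<-+ n _ _))

  Σ<-truncate : ∀ {m} n {f : ℕ → Carrier} → m ≤ n → (∀ k → m ≤ k → k < n → f k ≈ 0#) → Σ< n f ≈ Σ< m f
  Σ<-truncate {m} n m≤n f≈0 with ℕ.m≤n⇒m<n∨m≡n m≤n
  ... | inj₂ ≡.refl = refl
  Σ<-truncate {m} (suc n) m≤n f≈0 | inj₁ m<1+n = begin
    Σ< n _ + _  ≈⟨ +-cong (Σ<-truncate n (ℕ.<⇒≤pred m<1+n) (λ k m≤k k<n → f≈0 k m≤k (ℕ.m<n⇒m<1+n k<n)))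
                          (f≈0 n (ℕ.<⇒≤pred m<1+n) ℕ.≤-refl) ⟩
    Σ< m _ + 0# ≈⟨ +-identityʳ _ ⟩
    Σ< m _      ∎
    where open ≈-Reasoning

  -- The ring of formal power series

  𝟎 : Series
  𝟎 _ = 0#

  ⊝_ : Series → Series
  (⊝ f) n = - f n

  tail : Series → Series
  tail f n = f (suc n)

  ≋-refl : ∀ {f} → f ≋ f
  ≋-refl n = refl

  ≋-sym : ∀ {f g} → f ≋ g → g ≋ f
  ≋-sym f≋g n = sym (f≋g n)

  ≋-trans : ∀ {f g h} → f ≋ g → g ≋ h → f ≋ h
  ≋-trans f≋g g≋h n = trans (f≋g n) (g≋h n)

  ⊛-cong : ∀ {f f′ g g′} → f ≋ f′ → g ≋ g′ → f ⊛ g ≋ f′ ⊛ g′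
  ⊛-cong f≋f′ g≋g′ n = Σ<-congᵖ (suc n) (λ k → *-cong (f≋f′ k) (g≋g′ (n ℕ.∸ k)))

  ⊛-congˡ : ∀ {f g g′} → g ≋ g′ → f ⊛ g ≋ f ⊛ g′
  ⊛-congˡ {f} = ⊛-cong (≋-refl {f})

  ⊛-congʳ : ∀ h {f f′} → f ≋ f′ → f ⊛ h ≋ f′ ⊛ h
  ⊛-congʳ h f≋f′ = ⊛-cong f≋f′ (≋-refl {h})

  ⊛-coeff₀ : ∀ f g → (f ⊛ g) 0 ≈ f 0 * g 0
  ⊛-coeff₀ f g = +-identityˡ _

  ⊛-coeffsuc : ∀ f g n → (f ⊛ g) (suc n) ≈ f 0 * g (suc n) + (tail f ⊛ g) n
  ⊛-coeffsuc f g n = Σ<-suc (suc n) _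

  ⊛-split : ∀ f g → f ⊛ g ≋ f 0 ⊙ g ⊕ xmul (tail f ⊛ g)
  ⊛-split f g zero    = trans (⊛-coeff₀ f g) (sym (+-identityʳ _))
  ⊛-split f g (suc n) = ⊛-coeffsuc f g n

  ⊛-distribʳ : ∀ h f g → (f ⊕ g) ⊛ h ≋ f ⊛ h ⊕ g ⊛ h
  ⊛-distribʳ h f g n = trans (Σ<-congᵖ (suc n) (λ k → distribʳ _ _ _)) (Σ<-+ (suc n) _ _)

  ⊛-distribˡ : ∀ h f g → h ⊛ (f ⊕ g) ≋ h ⊛ f ⊕ h ⊛ g
  ⊛-distribˡ h f g n = trans (Σ<-congᵖ (suc n) (λ k → distribˡ _ _ _)) (Σ<-+ (suc n) _ _)

  ⊙-⊛ : ∀ k f g → (k ⊙ f) ⊛ g ≋ k ⊙ (f ⊛ g)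
  ⊙-⊛ k f g n = trans (Σ<-congᵖ (suc n) (λ i → *-assoc _ _ _)) (Σ<-*ˡ (suc n) k _)

  xmul-⊛ : ∀ f g → xmul f ⊛ g ≋ xmul (f ⊛ g)
  xmul-⊛ f g n = trans (⊛-split (xmul f) g n) (trans (+-congʳ (zeroˡ _)) (+-identityˡ _))

  ⊛-identityˡ : ∀ f → 𝟙 ⊛ f ≋ f
  ⊛-identityˡ f zero    = trans (⊛-coeff₀ 𝟙 f) (*-identityˡ _)
  ⊛-identityˡ f (suc n) = begin
    (𝟙 ⊛ f) (suc n)             ≈⟨ ⊛-coeffsuc 𝟙 f n ⟩
    1# * f (suc n) + (tail 𝟙 ⊛ f) n ≈⟨ +-cong (*-identityˡ _) (Σ<-zero (suc n) (λ k _ → zeroˡ _)) ⟩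
    f (suc n) + 0#              ≈⟨ +-identityʳ _ ⟩
    f (suc n)                   ∎
    where open ≈-Reasoning

  ⊛-comm : ∀ f g → f ⊛ g ≋ g ⊛ f
  ⊛-comm f g zero = trans (⊛-coeff₀ f g) (trans (*-comm _ _) (sym (⊛-coeff₀ g f)))
  ⊛-comm f g (suc zero) = begin
    (f ⊛ g) 1                   ≈⟨ ⊛-coeffsuc f g 0 ⟩
    f 0 * g 1 + (tail f ⊛ g) 0  ≈⟨ +-congˡ (trans (⊛-coeff₀ (tail f) g) (*-comm _ _)) ⟩
    f 0 * g 1 + g 0 * f 1       ≈⟨ +-comm _ _ ⟩
    g 0 * f 1 + f 0 * g 1       ≈⟨ +-congˡ (trans (*-comm _ _) (sym (⊛-coeff₀ (tail g) f))) ⟩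
    g 0 * f 1 + (tail g ⊛ f) 0  ≈⟨ ⊛-coeffsuc g f 0 ⟨
    (g ⊛ f) 1                   ∎
    where open ≈-Reasoning
  ⊛-comm f g (suc (suc n)) = begin
    (f ⊛ g) (2 ℕ.+ n)
      ≈⟨ ⊛-coeffsuc f g (suc n) ⟩
    f 0 * g (2 ℕ.+ n) + (tail f ⊛ g) (suc n)
      ≈⟨ +-congˡ (⊛-comm (tail f) g (suc n)) ⟩
    f 0 * g (2 ℕ.+ n) + (g ⊛ tail f) (suc n)
      ≈⟨ +-congˡ (⊛-coeffsuc g (tail f) n) ⟩
    f 0 * g (2 ℕ.+ n) + (g 0 * f (2 ℕ.+ n) + (tail g ⊛ tail f) n)
      ≈⟨ +-congˡ (+-congˡ (⊛-comm (tail g) (tail f) n)) ⟩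
    f 0 * g (2 ℕ.+ n) + (g 0 * f (2 ℕ.+ n) + (tail f ⊛ tail g) n)
      ≈⟨ x+[y+z]≈y+[x+z] _ _ _ ⟩
    g 0 * f (2 ℕ.+ n) + (f 0 * g (2 ℕ.+ n) + (tail f ⊛ tail g) n)
      ≈⟨ +-congˡ (⊛-coeffsuc f (tail g) n) ⟨
    g 0 * f (2 ℕ.+ n) + (f ⊛ tail g) (suc n)
      ≈⟨ +-congˡ (⊛-comm f (tail g) (suc n)) ⟩
    g 0 * f (2 ℕ.+ n) + (tail g ⊛ f) (suc n)
      ≈⟨ ⊛-coeffsuc g f (suc n) ⟨
    (g ⊛ f) (2 ℕ.+ n) ∎
    where open ≈-Reasoning

  ⊛-assoc : ∀ f g h → (f ⊛ g) ⊛ h ≋ f ⊛ (g ⊛ h)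
  ⊛-assoc f g h n = begin
    ((f ⊛ g) ⊛ h) n                               ≈⟨ ⊛-congʳ h (⊛-split f g) n ⟩
    ((f 0 ⊙ g ⊕ xmul (tail f ⊛ g)) ⊛ h) n          ≈⟨ ⊛-distribʳ h _ _ n ⟩
    ((f 0 ⊙ g) ⊛ h) n + (xmul (tail f ⊛ g) ⊛ h) n ≈⟨ +-cong (⊙-⊛ (f 0) g h n) (xmul-⊛ _ h n) ⟩
    f 0 * (g ⊛ h) n + xmul ((tail f ⊛ g) ⊛ h) n  ≈⟨ +-congˡ (shifted n) ⟩
    f 0 * (g ⊛ h) n + xmul (tail f ⊛ (g ⊛ h)) n  ≈⟨ ⊛-split f (g ⊛ h) n ⟨
    (f ⊛ (g ⊛ h)) n                               ∎
    where
    open ≈-Reasoning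
    shifted : ∀ n → xmul ((tail f ⊛ g) ⊛ h) n ≈ xmul (tail f ⊛ (g ⊛ h)) n
    shifted zero    = refl
    shifted (suc n) = ⊛-assoc (tail f) g h n

  seriesRing : CommutativeRing c ℓ
  seriesRing = record
    { Carrier = Series ; _≈_ = _≋_ ; _+_ = _⊕_ ; _*_ = _⊛_ ; -_ = ⊝_ ; 0# = 𝟎 ; 1# = 𝟙
    ; isCommutativeRing = record
      { isRing = record
        { +-isAbelianGroup = record
          { isGroup = record
            { isMonoid = record
              { isSemigroup = record
                { isMagma = record
                  { isEquivalence = record { refl = ≋-refl ; sym = ≋-sym ; trans = ≋-trans }
                  ; ∙-cong = λ f≋f′ g≋g′ n → +-cong (f≋f′ n) (g≋g′ n) }
                ; assoc = λ f g h n → +-assoc _ _ _ }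
              ; identity = (λ f n → +-identityˡ _) , (λ f n → +-identityʳ _) }
            ; inverse = (λ f n → -‿inverseˡ _) , (λ f n → -‿inverseʳ _)
            ; ⁻¹-cong = λ f≋g n → -‿cong (f≋g n) }
          ; comm = λ f g n → +-comm _ _ }
        ; *-cong = ⊛-cong
        ; *-assoc = ⊛-assoc
        ; *-identity = ⊛-identityˡ , (λ f → ≋-trans (⊛-comm f 𝟙) (⊛-identityˡ f))
        ; distrib = ⊛-distribˡ , ⊛-distribʳ }
      ; *-comm = ⊛-comm } }

  module 𝕊 = IntegerRingSolver seriesRing
  module 𝔽 = IntegerRingSolver commutativeRing
  module ≋-Reasoning = SetoidReasoning (CommutativeRing.setoid seriesRing)
  open CommutativeRing seriesRing using ()
    renaming (+-cong to ⊕-cong; +-congˡ to ⊕-congˡ; +-congʳ to ⊕-congʳ; -‿cong to ⊝-cong)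
  open GroupProperties (CommutativeRing.+-group seriesRing) using ()
    renaming (x∙y⁻¹≈ε⇒x≈y to f⊖g≋𝟎⇒f≋g; x≈y⇒x∙y⁻¹≈ε to f≋g⇒f⊖g≋𝟎)

  const-cong : ∀ {x y} → x ≈ y → const x ≋ const y
  const-cong x≈y zero    = x≈y
  const-cong x≈y (suc n) = refl

  const-+ : ∀ x y → const (x + y) ≋ const x ⊕ const y
  const-+ x y zero    = refl
  const-+ x y (suc n) = sym (+-identityʳ 0#)

  const-neg : ∀ x → const (- x) ≋ ⊝ const x
  const-neg x zero    = refl
  const-neg x (suc n) = sym ε⁻¹≈ε

  ⊙≋const⊛ : ∀ k f → k ⊙ f ≋ const k ⊛ f
  ⊙≋const⊛ k f n = sym (begin
    (const k ⊛ f) n                         ≈⟨ ⊛-split (const k) f n ⟩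
    k * f n + xmul (tail (const k) ⊛ f) n   ≈⟨ +-congˡ (tail-vanishes n) ⟩
    k * f n + 0#                            ≈⟨ +-identityʳ _ ⟩
    k * f n                                 ∎)
    where
    open ≈-Reasoning
    tail-vanishes : ∀ n → xmul (tail (const k) ⊛ f) n ≈ 0#
    tail-vanishes zero    = refl
    tail-vanishes (suc n) = Σ<-zero (suc n) (λ i _ → zeroˡ _)

  const-* : ∀ x y → const (x * y) ≋ const x ⊛ const y
  const-* x y = ≋-trans x*y≋x⊙y (⊙≋const⊛ x (const y))
    where
    x*y≋x⊙y : const (x * y) ≋ x ⊙ const y
    x*y≋x⊙y zero    = refl
    x*y≋x⊙y (suc n) = sym (zeroʳ x)

  xmul≋X⊛ : ∀ f → xmul f ≋ X ⊛ f
  xmul≋X⊛ f = ≋-sym (≋-trans (xmul-⊛ 𝟙 f) xmul[𝟙⊛f]≋xmul[f])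
    where
    xmul[𝟙⊛f]≋xmul[f] : xmul (𝟙 ⊛ f) ≋ xmul f
    xmul[𝟙⊛f]≋xmul[f] zero    = refl
    xmul[𝟙⊛f]≋xmul[f] (suc n) = ⊛-identityˡ f n

  ⊙xmul≋const⊛X⊛ : ∀ k f → k ⊙ xmul f ≋ const k ⊛ (X ⊛ f)
  ⊙xmul≋const⊛X⊛ k f = ≋-trans (⊙≋const⊛ k (xmul f)) (⊛-congˡ (xmul≋X⊛ f))

  X⊛-coeff₀ : ∀ f → (X ⊛ f) 0 ≈ 0#
  X⊛-coeff₀ f = trans (⊛-coeff₀ X f) (zeroˡ _)

  𝟙⊖X⊛-coeff₀ : ∀ f → (𝟙 ⊖ X ⊛ f) 0 ≈ 1#
  𝟙⊖X⊛-coeff₀ f = trans (+-congˡ (trans (-‿cong (X⊛-coeff₀ f)) ε⁻¹≈ε)) (+-identityʳ 1#)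

  X⊛-injective : ∀ {f g} → X ⊛ f ≋ X ⊛ g → f ≋ g
  X⊛-injective {f} {g} Xf≋Xg n = trans (xmul≋X⊛ f (suc n)) (trans (Xf≋Xg (suc n)) (sym (xmul≋X⊛ g (suc n))))

  ⊛-annihilatorˡ : ∀ {P Q} → Q 0 ≈ 1# → P ⊛ Q ≋ 𝟎 → P ≋ 𝟎
  ⊛-annihilatorˡ {P} {Q} Q₀≈1 PQ≋𝟎 = <-rec (λ k → P k ≈ 0#) step
    where
    step : ∀ k → (∀ {i} → i < k → P i ≈ 0#) → P k ≈ 0#
    step k P<k≈0 = begin
      P k                               ≈⟨ *-identityʳ _ ⟨
      P k * 1#                          ≈⟨ *-congˡ (trans (sym Q₀≈1) (reflexive (≡.cong Q (≡.sym (ℕ.n∸n≡0 k))))) ⟩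
      P k * Q (k ℕ.∸ k)                 ≈⟨ +-identityˡ _ ⟨
      0# + P k * Q (k ℕ.∸ k)            ≈⟨ +-congʳ (Σ<-zero k (λ i i<k → trans (*-congʳ (P<k≈0 i<k)) (zeroˡ _))) ⟨
      (P ⊛ Q) k                         ≈⟨ PQ≋𝟎 k ⟩
      0#                                ∎
      where open ≈-Reasoning

  ⊛-cancelʳ : ∀ {P P′ Q} → Q 0 ≈ 1# → P ⊛ Q ≋ P′ ⊛ Q → P ≋ P′
  ⊛-cancelʳ {P} {P′} {Q} Q₀≈1 PQ≋P′Q = f⊖g≋𝟎⇒f≋g P P′ (⊛-annihilatorˡ {Q = Q} Q₀≈1 (begin
    (P ⊖ P′) ⊛ Q        ≈⟨ solve 3 (λ P P′ Q → (P :- P′) :* Q := P :* Q :- P′ :* Q) ≋-refl P P′ Q ⟩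
    P ⊛ Q ⊖ P′ ⊛ Q      ≈⟨ f≋g⇒f⊖g≋𝟎 PQ≋P′Q ⟩
    𝟎                   ∎))
    where
    open 𝕊
    open ≋-Reasoning

  -- Composition

  pow-cong : ∀ {y y′} → y ≋ y′ → ∀ k → pow y k ≋ pow y′ k
  pow-cong y≋y′ zero    = ≋-refl
  pow-cong y≋y′ (suc k) = ⊛-cong y≋y′ (pow-cong y≋y′ k)

  compose-congˡ : ∀ {g g′} y → g ≋ g′ → compose g y ≋ compose g′ y
  compose-congˡ y g≋g′ n = Σ<-congᵖ (suc n) (λ k → *-congʳ (g≋g′ k))

  compose-congʳ : ∀ g {y y′} → y ≋ y′ → compose g y ≋ compose g y′
  compose-congʳ g y≋y′ n = Σ<-congᵖ (suc n) (λ k → *-congˡ (pow-cong y≋y′ k n))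

  compose-⊕ : ∀ f g y → compose (f ⊕ g) y ≋ compose f y ⊕ compose g y
  compose-⊕ f g y n = trans (Σ<-congᵖ (suc n) (λ k → distribʳ _ _ _)) (Σ<-+ (suc n) _ _)

  compose-⊙ : ∀ k f y → compose (k ⊙ f) y ≋ k ⊙ compose f y
  compose-⊙ k f y n = trans (Σ<-congᵖ (suc n) (λ i → *-assoc _ _ _)) (Σ<-*ˡ (suc n) k _)

  compose-𝟙 : ∀ y → compose 𝟙 y ≋ 𝟙
  compose-𝟙 y n = trans (Σ<-suc n _) (trans (+-cong (*-identityˡ _) (Σ<-zero n (λ k _ → zeroˡ _))) (+-identityʳ _))

  module _ {y : Series} (y₀≈0 : y 0 ≈ 0#) where

    pow-vanishes : ∀ {n} k → n < k → pow y k n ≈ 0#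
    pow-vanishes {zero}  (suc k) _ = trans (⊛-coeff₀ y (pow y k)) (trans (*-congʳ y₀≈0) (zeroˡ _))
    pow-vanishes {suc n} (suc k) (s≤s n<k) = begin
      (y ⊛ pow y k) (suc n)
        ≈⟨ ⊛-coeffsuc y (pow y k) n ⟩
      y 0 * pow y k (suc n) + (tail y ⊛ pow y k) n
        ≈⟨ +-cong (trans (*-congʳ y₀≈0) (zeroˡ _)) (Σ<-zero (suc n) later-vanish) ⟩
      0# + 0#
        ≈⟨ +-identityˡ 0# ⟩
      0# ∎
      where
      open ≈-Reasoning
      later-vanish : ∀ i → i < suc n → tail y i * pow y k (n ℕ.∸ i) ≈ 0#
      later-vanish i _ = trans (*-congˡ (pow-vanishes k (ℕ.≤-<-trans (ℕ.m∸n≤m n i) n<k))) (zeroʳ _)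

    compose-truncate : ∀ g {n N} → n < N → Σ< N (λ k → g k * pow y k n) ≈ compose g y n
    compose-truncate g {n} n<N =
      Σ<-truncate _ n<N (λ k n<k _ → trans (*-congˡ (pow-vanishes k n<k)) (zeroʳ _))

    compose-xmul : ∀ g → compose (xmul g) y ≋ y ⊛ compose g y
    compose-xmul g n = begin
      compose (xmul g) y n
        ≈⟨ Σ<-suc n _ ⟩
      0# * pow y 0 n + Σ< n (λ k → g k * pow y (suc k) n)
        ≈⟨ trans (+-congʳ (zeroˡ _)) (+-identityˡ _) ⟩
      Σ< n (λ k → g k * Σ< (suc n) (λ i → y i * pow y k (n ℕ.∸ i)))
        ≈⟨ Σ<-congᵖ n (λ k → Σ<-*ˡ (suc n) (g k) _) ⟨
      Σ< n (λ k → Σ< (suc n) (λ i → g k * (y i * pow y k (n ℕ.∸ i))))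
        ≈⟨ Σ<-swap n (suc n) _ ⟩
      Σ< (suc n) (λ i → Σ< n (λ k → g k * (y i * pow y k (n ℕ.∸ i))))
        ≈⟨ Σ<-congᵖ (suc n) (λ i → trans (Σ<-congᵖ n (λ k → x*[y*z]≈y*[x*z] _ _ _)) (Σ<-*ˡ n (y i) _)) ⟩
      Σ< (suc n) (λ i → y i * Σ< n (λ k → g k * pow y k (n ℕ.∸ i)))
        ≈⟨ Σ<-cong (suc n) truncated ⟩
      (y ⊛ compose g y) n ∎
      where
      open ≈-Reasoning
      truncated : ∀ i → i < suc n → y i * Σ< n (λ k → g k * pow y k (n ℕ.∸ i)) ≈ y i * compose g y (n ℕ.∸ i)
      truncated zero    _         = trans (*-congʳ y₀≈0) (trans (zeroˡ _) (sym (trans (*-congʳ y₀≈0) (zeroˡ _))))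
      truncated (suc i) (s≤s i<n) = *-congˡ (compose-truncate g (ℕ.∸-monoʳ-< ℕ.z<s i<n))

  compose-const⊛ : ∀ k g y → compose (const k ⊛ g) y ≋ const k ⊛ compose g y
  compose-const⊛ k g y =
    ≋-trans (compose-congˡ y (≋-sym (⊙≋const⊛ k g))) (≋-trans (compose-⊙ k g y) (⊙≋const⊛ k _))

  compose-X⊛ : ∀ {y} → y 0 ≈ 0# → ∀ g → compose (X ⊛ g) y ≋ y ⊛ compose g y
  compose-X⊛ {y} y₀≈0 g = ≋-trans (compose-congˡ y (≋-sym (xmul≋X⊛ g))) (compose-xmul y₀≈0 g)

  -- The binomial transform

  binomialTransform-cong : ∀ {f g} → f ≋ g → binomialTransform f ≋ binomialTransform g
  binomialTransform-cong f≋g n = Σ<-congᵖ (suc n) (λ k → ×-congʳ (n C k) (f≋g k))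

  binomialTransform-⊕ : ∀ f g → binomialTransform (f ⊕ g) ≋ binomialTransform f ⊕ binomialTransform g
  binomialTransform-⊕ f g n = trans (Σ<-congᵖ (suc n) (λ k → ×-distrib-+ (f k) (g k) (n C k))) (Σ<-+ (suc n) _ _)

  binomialTransform-⊙ : ∀ k f → binomialTransform (k ⊙ f) ≋ k ⊙ binomialTransform f
  binomialTransform-⊙ k f n = trans (Σ<-congᵖ (suc n) (λ i → sym (×-comm-* (n C i) k (f i)))) (Σ<-*ˡ (suc n) k _)

  binomialTransform-𝟎 : binomialTransform 𝟎 ≋ 𝟎
  binomialTransform-𝟎 n = Σ<-zero (suc n) (λ k _ → n×0≈0 (n C k))
    where
    n×0≈0 : ∀ m → m × 0# ≈ 0#
    n×0≈0 m = trans (×-congʳ m (sym (zeroˡ 0#))) (trans (sym (×-comm-* m 0# 0#)) (zeroˡ _))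

  -- Pascal's rule C(n+1,k+1) = C(n,k) + C(n,k+1), summed against f.
  binomialTransform-coeffsuc : ∀ f n →
    binomialTransform f (suc n) ≈ binomialTransform f n + binomialTransform (tail f) n
  binomialTransform-coeffsuc f n = begin
    T f (suc n)
      ≈⟨ Σ<-suc (suc n) _ ⟩
    1 × f 0 + Σ< (suc n) (λ k → (suc n C suc k) × f (suc k))
      ≈⟨ +-cong (+-identityʳ _) (Σ<-congᵖ (suc n) pascal) ⟩
    f 0 + Σ< (suc n) (λ k → (n C k) × f (suc k) + (n C suc k) × f (suc k))
      ≈⟨ +-congˡ (Σ<-+ (suc n) _ _) ⟩
    f 0 + (T (tail f) n + (Σ< n (λ k → (n C suc k) × f (suc k)) + (n C suc n) × f (suc n)))
      ≈⟨ +-congˡ (+-congˡ (+-congˡ C[n,n+1]≈0)) ⟩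
    f 0 + (T (tail f) n + (Σ< n (λ k → (n C suc k) × f (suc k)) + 0#))
      ≈⟨ +-congˡ (+-congˡ (+-identityʳ _)) ⟩
    f 0 + (T (tail f) n + Σ< n (λ k → (n C suc k) × f (suc k)))
      ≈⟨ +-congˡ (+-comm _ _) ⟩
    f 0 + (Σ< n (λ k → (n C suc k) × f (suc k)) + T (tail f) n)
      ≈⟨ +-assoc _ _ _ ⟨
    (f 0 + Σ< n (λ k → (n C suc k) × f (suc k))) + T (tail f) n
      ≈⟨ +-congʳ (trans (Σ<-suc n _) (+-congʳ (+-identityʳ _))) ⟨
    T f n + T (tail f) n ∎
    where
    open ≈-Reasoning
    T : Series → Series
    T = binomialTransform
    pascal : ∀ k → (suc n C suc k) × f (suc k) ≈ (n C k) × f (suc k) + (n C suc k) × f (suc k)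
    pascal k = trans (reflexive (≡.cong (_× f (suc k)) (≡.sym (nCk+nC[k+1]≡[n+1]C[k+1] n k))))
                     (×-homo-+ (f (suc k)) (n C k) (n C suc k))
    C[n,n+1]≈0 : (n C suc n) × f (suc n) ≈ 0#
    C[n,n+1]≈0 = reflexive (≡.cong (_× f (suc n)) (k>n⇒nCk≡0 (ℕ.n<1+n n)))

  binomialTransform-⊖ : ∀ f g → binomialTransform (f ⊖ g) ≋ binomialTransform f ⊖ binomialTransform g
  binomialTransform-⊖ f g = ≋-trans (binomialTransform-⊕ f (⊝ g)) (⊕-congˡ T-⊝)
    where
    -1⊙≋⊝ : ∀ h → (- 1#) ⊙ h ≋ ⊝ h
    -1⊙≋⊝ h n = trans (sym (-‿distribˡ-* 1# (h n))) (-‿cong (*-identityˡ _))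
    T-⊝ : binomialTransform (⊝ g) ≋ ⊝ binomialTransform g
    T-⊝ = ≋-trans (binomialTransform-cong (≋-sym (-1⊙≋⊝ g))) (≋-trans (binomialTransform-⊙ (- 1#) g) (-1⊙≋⊝ _))

  binomialTransform-const⊛ : ∀ k f → binomialTransform (const k ⊛ f) ≋ const k ⊛ binomialTransform f
  binomialTransform-const⊛ k f =
    ≋-trans (binomialTransform-cong (≋-sym (⊙≋const⊛ k f))) (≋-trans (binomialTransform-⊙ k f) (⊙≋const⊛ k _))

  binomialTransform-coeff₀ : ∀ f → binomialTransform f 0 ≈ f 0
  binomialTransform-coeff₀ f = trans (+-identityˡ _) (+-identityʳ _)

  binomialTransform-pascal : ∀ f → (𝟙 ⊖ X) ⊛ binomialTransform f ≋ const (f 0) ⊕ X ⊛ binomialTransform (tail f)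
  binomialTransform-pascal f = begin
    (𝟙 ⊖ X) ⊛ T f
      ≈⟨ solve 2 (λ x t → (con (+ 1) :- x) :* t := t :- x :* t) ≋-refl X (T f) ⟩
    T f ⊖ X ⊛ T f
      ≈⟨ ⊕-congʳ recurrence ⟩
    const (f 0) ⊕ X ⊛ (T f ⊕ T (tail f)) ⊖ X ⊛ T f
      ≈⟨ solve 4 (λ x k t t′ → k :+ x :* (t :+ t′) :- x :* t := k :+ x :* t′) ≋-refl
           X (const (f 0)) (T f) (T (tail f)) ⟩
    const (f 0) ⊕ X ⊛ T (tail f) ∎
    where
    open 𝕊
    open ≋-Reasoning
    T : Series → Series
    T = binomialTransform
    recurrence : T f ≋ const (f 0) ⊕ X ⊛ (T f ⊕ T (tail f))
    recurrence zero    =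
      trans (binomialTransform-coeff₀ f) (sym (trans (+-congˡ (X⊛-coeff₀ (T f ⊕ T (tail f)))) (+-identityʳ _)))
    recurrence (suc n) =
      trans (binomialTransform-coeffsuc f n) (trans (xmul≋X⊛ (T f ⊕ T (tail f)) (suc n)) (sym (+-identityˡ _)))

  binomialTransform-𝟙 : (𝟙 ⊖ X) ⊛ binomialTransform 𝟙 ≋ 𝟙
  binomialTransform-𝟙 = begin
    (𝟙 ⊖ X) ⊛ binomialTransform 𝟙 ≈⟨ binomialTransform-pascal 𝟙 ⟩
    𝟙 ⊕ X ⊛ binomialTransform 𝟎   ≈⟨ ⊕-congˡ (⊛-congˡ binomialTransform-𝟎) ⟩
    𝟙 ⊕ X ⊛ 𝟎                     ≈⟨ solve 1 (λ x → con (+ 1) :+ x :* con (+ 0) := con (+ 1)) ≋-refl X ⟩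
    𝟙                             ∎
    where
    open 𝕊
    open ≋-Reasoning

  binomialTransform-X⊛ : ∀ f → (𝟙 ⊖ X) ⊛ binomialTransform (X ⊛ f) ≋ X ⊛ binomialTransform f
  binomialTransform-X⊛ f = begin
    (𝟙 ⊖ X) ⊛ binomialTransform (X ⊛ f)
      ≈⟨ binomialTransform-pascal (X ⊛ f) ⟩
    const ((X ⊛ f) 0) ⊕ X ⊛ binomialTransform (tail (X ⊛ f))
      ≈⟨ ⊕-cong constant-vanishes (⊛-congˡ (binomialTransform-cong tail≋f)) ⟩
    𝟎 ⊕ X ⊛ binomialTransform f
      ≈⟨ solve 1 (λ y → con (+ 0) :+ y := y) ≋-refl (X ⊛ binomialTransform f) ⟩
    X ⊛ binomialTransform f ∎
    where
    open 𝕊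
    open ≋-Reasoning
    constant-vanishes : const ((X ⊛ f) 0) ≋ 𝟎
    constant-vanishes zero    = X⊛-coeff₀ f
    constant-vanishes (suc n) = refl
    tail≋f : tail (X ⊛ f) ≋ f
    tail≋f n = sym (xmul≋X⊛ f (suc n))

  binomialTransform-pascal-⊛ : ∀ f h →
    (𝟙 ⊖ X) ⊛ binomialTransform f ⊛ h ≋ f 0 ⊙ h ⊕ xmul (binomialTransform (tail f) ⊛ h)
  binomialTransform-pascal-⊛ f h = begin
    (𝟙 ⊖ X) ⊛ T f ⊛ h
      ≈⟨ ⊛-congʳ h (binomialTransform-pascal f) ⟩
    (const (f 0) ⊕ X ⊛ T (tail f)) ⊛ h
      ≈⟨ solve 4 (λ x k t h → (k :+ x :* t) :* h := k :* h :+ x :* (t :* h)) ≋-refl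
           X (const (f 0)) (T (tail f)) h ⟩
    const (f 0) ⊛ h ⊕ X ⊛ (T (tail f) ⊛ h)
      ≈⟨ ⊕-cong (⊙≋const⊛ (f 0) h) (xmul≋X⊛ _) ⟨
    f 0 ⊙ h ⊕ xmul (T (tail f) ⊛ h) ∎
    where
    open 𝕊
    open ≋-Reasoning
    T : Series → Series
    T = binomialTransform

  mutual
    binomialTransform-⊛ : ∀ f g → binomialTransform (f ⊛ g) ≋ (𝟙 ⊖ X) ⊛ binomialTransform f ⊛ binomialTransform g
    binomialTransform-⊛ f g n = begin
      T (f ⊛ g) n
        ≈⟨ binomialTransform-cong (⊛-split f g) n ⟩
      T (f 0 ⊙ g ⊕ xmul (tail f ⊛ g)) n
        ≈⟨ binomialTransform-⊕ _ _ n ⟩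
      T (f 0 ⊙ g) n + T (xmul (tail f ⊛ g)) n
        ≈⟨ +-cong (binomialTransform-⊙ (f 0) g n) (binomialTransform-xmul-⊛ (tail f) g n) ⟩
      f 0 * T g n + xmul (T (tail f) ⊛ T g) n
        ≈⟨ binomialTransform-pascal-⊛ f (T g) n ⟨
      ((𝟙 ⊖ X) ⊛ T f ⊛ T g) n ∎
      where
      open ≈-Reasoning
      T : Series → Series
      T = binomialTransform

    binomialTransform-xmul-⊛ : ∀ f g → binomialTransform (xmul (f ⊛ g)) ≋ xmul (binomialTransform f ⊛ binomialTransform g)
    binomialTransform-xmul-⊛ f g zero    = binomialTransform-coeff₀ (xmul (f ⊛ g))
    binomialTransform-xmul-⊛ f g (suc n) = begin
      T (xmul (f ⊛ g)) (suc n)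
        ≈⟨ binomialTransform-coeffsuc _ n ⟩
      T (xmul (f ⊛ g)) n + T (f ⊛ g) n
        ≈⟨ +-cong (binomialTransform-xmul-⊛ f g n) (binomialTransform-⊛ f g n) ⟩
      xmul (T f ⊛ T g) n + ((𝟙 ⊖ X) ⊛ T f ⊛ T g) n
        ≈⟨ +-congʳ (xmul≋X⊛ _ n) ⟩
      (X ⊛ (T f ⊛ T g) ⊕ (𝟙 ⊖ X) ⊛ T f ⊛ T g) n
        ≈⟨ solve 3 (λ x a b → x :* (a :* b) :+ (con (+ 1) :- x) :* a :* b := a :* b) ≋-refl X (T f) (T g) n ⟩
      (T f ⊛ T g) n ∎
      where
      open 𝕊
      open ≈-Reasoning
      T : Series → Series
      T = binomialTransform

  -- Thron tails

  causal-fixpoint : (F : ℕ → Series → Carrier) →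
    (∀ n {f g} → (∀ k → k < n → f k ≈ g k) → F n f ≈ F n g) →
    ∃ λ U → ∀ n → U n ≈ F n U
  causal-fixpoint F F-causal = U , λ n → F-causal n (λ k k<n → sym (approx-stable (suc k) n k ℕ.≤-refl k<n))
    where
    approx : ℕ → Series
    approx zero    = 𝟎
    approx (suc m) k = F k (approx m)

    approx-stable : ∀ m m′ k → k < m → m ≤ m′ → approx m k ≈ approx m′ k
    approx-stable (suc m) (suc m′) k k<1+m (s≤s m≤m′) =
      F-causal k (λ j j<k → approx-stable m m′ j (ℕ.<-≤-trans j<k (ℕ.<⇒≤pred k<1+m)) m≤m′)

    U : Series
    U n = approx (suc n) n

  thronDenominator : Carrier → Carrier → Series → Series
  thronDenominator q s U = 𝟙 ⊖ q ⊙ X ⊖ s ⊙ xmul U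

  thronDenominator≋ : ∀ q s U → thronDenominator q s U ≋ 𝟙 ⊖ X ⊛ (const q ⊕ const s ⊛ U)
  thronDenominator≋ q s U = begin
    𝟙 ⊖ q ⊙ X ⊖ s ⊙ xmul U
      ≈⟨ ⊕-cong (⊕-congˡ (⊝-cong (⊙≋const⊛ q X))) (⊝-cong (⊙xmul≋const⊛X⊛ s U)) ⟩
    𝟙 ⊖ const q ⊛ X ⊖ const s ⊛ (X ⊛ U)
      ≈⟨ solve 4 (λ x u k l → con (+ 1) :- k :* x :- l :* (x :* u) := con (+ 1) :- x :* (k :+ l :* u))
            ≋-refl X U (const q) (const s) ⟩
    𝟙 ⊖ X ⊛ (const q ⊕ const s ⊛ U) ∎
    where
    open 𝕊
    open ≋-Reasoning

  -- The coefficient recursion of U = 1 + r x U + s x U².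
  thronStep : Carrier → Carrier → ℕ → Series → Carrier
  thronStep r s zero    f = 1#
  thronStep r s (suc n) f = r * f n + s * (f ⊛ f) n

  thronStep-causal : ∀ r s n {f g} → (∀ k → k < n → f k ≈ g k) → thronStep r s n f ≈ thronStep r s n g
  thronStep-causal r s zero    f≈g = refl
  thronStep-causal r s (suc n) f≈g = +-cong (*-congˡ (f≈g n ℕ.≤-refl)) (*-congˡ (Σ<-cong (suc n) (λ k k<1+n →
    *-cong (f≈g k k<1+n) (f≈g (n ℕ.∸ k) (s≤s (ℕ.m∸n≤m n k))))))

  thronStep-fixpoint-coefficients : ∀ {r s U} → (∀ n → U n ≈ thronStep r s n U) →
    U ⊖ r ⊙ xmul U ⊖ s ⊙ xmul (U ⊛ U) ≋ 𝟙
  thronStep-fixpoint-coefficients {r} {s} U≈step zero = trans (+-congʳ (+-congʳ (U≈step 0)))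
    (solve 2 (λ r s → con (+ 1) :- r :* con (+ 0) :- s :* con (+ 0) := con (+ 1)) refl r s)
    where open 𝔽
  thronStep-fixpoint-coefficients U≈step (suc n) = trans (+-congʳ (+-congʳ (U≈step (suc n))))
    (solve 2 (λ x y → (x :+ y) :- x :- y := con (+ 0)) refl _ _)
    where open 𝔽

  thronStep-fixpoint⇒thronTail : ∀ {r s U} → (∀ n → U n ≈ thronStep r s n U) → IsThronTail r s U
  thronStep-fixpoint⇒thronTail {r} {s} {U} U≈step = begin
    U ⊛ thronDenominator r s U
      ≈⟨ ⊛-congˡ (thronDenominator≋ r s U) ⟩
    U ⊛ (𝟙 ⊖ X ⊛ (const r ⊕ const s ⊛ U))
      ≈⟨ solve 4 (λ x u k l → u :* (con (+ 1) :- x :* (k :+ l :* u))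
                            := u :- k :* (x :* u) :- l :* (x :* (u :* u)))
            ≋-refl X U (const r) (const s) ⟩
    U ⊖ const r ⊛ (X ⊛ U) ⊖ const s ⊛ (X ⊛ (U ⊛ U))
      ≈⟨ ⊕-cong (⊕-congˡ (⊝-cong (⊙xmul≋const⊛X⊛ r U))) (⊝-cong (⊙xmul≋const⊛X⊛ s (U ⊛ U))) ⟨
    U ⊖ r ⊙ xmul U ⊖ s ⊙ xmul (U ⊛ U)
      ≈⟨ thronStep-fixpoint-coefficients U≈step ⟩
    𝟙 ∎
    where
    open 𝕊
    open ≋-Reasoning

  thronTail-exists : ∀ r s → ∃ (IsThronTail r s)
  thronTail-exists r s = map₂ thronStep-fixpoint⇒thronTail (causal-fixpoint (thronStep r s) (thronStep-causal r s))

  -- Quadratic equations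

  reciprocal-quadratic : ∀ {B W L N} → B ⊛ W ≋ 𝟙 → W ≋ L ⊕ N ⊛ B → W ⊛ W ≋ L ⊛ W ⊕ N
  reciprocal-quadratic {B} {W} {L} {N} BW≋𝟙 W≋L+NB = begin
    W ⊛ W               ≈⟨ ⊛-congˡ W≋L+NB ⟩
    W ⊛ (L ⊕ N ⊛ B)     ≈⟨ solve 4 (λ w l n b → w :* (l :+ n :* b) := l :* w :+ n :* (b :* w)) ≋-refl W L N B ⟩
    L ⊛ W ⊕ N ⊛ (B ⊛ W) ≈⟨ ⊕-congˡ (⊛-congˡ BW≋𝟙) ⟩
    L ⊛ W ⊕ N ⊛ 𝟙       ≈⟨ solve 3 (λ w l n → l :* w :+ n :* con (+ 1) := l :* w :+ n) ≋-refl W L N ⟩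
    L ⊛ W ⊕ N           ∎
    where
    open 𝕊
    open ≋-Reasoning

  quadratic-root-⊛ : ∀ {L M Z} Z′ → Z ⊛ Z ≋ L ⊛ Z ⊕ M → Z ⊛ (Z ⊕ Z′ ⊖ L) ≋ Z ⊛ Z′ ⊕ M
  quadratic-root-⊛ {L} {M} {Z} Z′ Z²≋LZ+M = begin
    Z ⊛ (Z ⊕ Z′ ⊖ L)
      ≈⟨ solve 3 (λ z z′ l → z :* (z :+ z′ :- l) := z :* z :- l :* z :+ z :* z′) ≋-refl Z Z′ L ⟩
    Z ⊛ Z ⊖ L ⊛ Z ⊕ Z ⊛ Z′
      ≈⟨ ⊕-congʳ (⊕-congʳ Z²≋LZ+M) ⟩
    L ⊛ Z ⊕ M ⊖ L ⊛ Z ⊕ Z ⊛ Z′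
      ≈⟨ solve 4 (λ z z′ l m → l :* z :+ m :- l :* z :+ z :* z′ := z :* z′ :+ m) ≋-refl Z Z′ L M ⟩
    Z ⊛ Z′ ⊕ M ∎
    where
    open 𝕊
    open ≋-Reasoning

  -- (Z - Z′)(Z + Z′ - L) = 0, and the second factor has constant term 1.
  quadratic-root-unique : ∀ {L M Z Z′} → L 0 ≈ 1# → Z 0 ≈ 1# → Z′ 0 ≈ 1# →
    Z ⊛ Z ≋ L ⊛ Z ⊕ M → Z′ ⊛ Z′ ≋ L ⊛ Z′ ⊕ M → Z ≋ Z′
  quadratic-root-unique {L} {M} {Z} {Z′} L₀≈1 Z₀≈1 Z′₀≈1 Z-root Z′-root =
    ⊛-cancelʳ {Q = Z ⊕ Z′ ⊖ L} Q₀≈1 (begin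
      Z ⊛ (Z ⊕ Z′ ⊖ L)    ≈⟨ quadratic-root-⊛ Z′ Z-root ⟩
      Z ⊛ Z′ ⊕ M          ≈⟨ ⊕-congʳ (⊛-comm Z Z′) ⟩
      Z′ ⊛ Z ⊕ M          ≈⟨ quadratic-root-⊛ Z Z′-root ⟨
      Z′ ⊛ (Z′ ⊕ Z ⊖ L)   ≈⟨ ⊛-congˡ (⊕-congʳ {⊝ L} (λ n → +-comm (Z′ n) (Z n))) ⟩
      Z′ ⊛ (Z ⊕ Z′ ⊖ L)   ∎)
    where
    open ≋-Reasoning
    Q₀≈1 : Z 0 + Z′ 0 - L 0 ≈ 1#
    Q₀≈1 = trans (+-cong (+-cong Z₀≈1 Z′₀≈1) (-‿cong L₀≈1))
                 (solve 0 (con (+ 1) :+ con (+ 1) :- con (+ 1) := con (+ 1)) refl)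
      where
      open 𝔽

  revert-equation : ∀ {a b c h A} →
    h ⊛ (𝟙 ⊕ b ⊙ X ⊕ c ⊙ pow X 2) ≋ 𝟙 ⊕ a ⊙ X →
    compose (xmul h) (xmul A) ≋ X →
    A ≋ 𝟙 ⊕ X ⊛ (const b ⊛ A ⊖ const a ⊛ (A ⊛ A) ⊕ const c ⊛ (X ⊛ (A ⊛ A)))
  revert-equation {a} {b} {c} {h} {A} h-equation xA∘xh≋X = X⊛-injective (begin
    X ⊛ A
      ≈⟨ solve 3 (λ x A ca → x :* A := x :* A :* (con (+ 1) :+ ca :* (x :* A)) :- ca :* (x :* A :* (x :* A)))
            ≋-refl X A ca ⟩
    Y ⊛ (𝟙 ⊕ ca ⊛ Y) ⊖ ca ⊛ (Y ⊛ Y)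
      ≈⟨ ⊕-congʳ substituted ⟩
    X ⊛ (𝟙 ⊕ cb ⊛ Y ⊕ cc ⊛ (Y ⊛ Y)) ⊖ ca ⊛ (Y ⊛ Y)
      ≈⟨ solve 5 (λ x A ca cb cc →
           x :* (con (+ 1) :+ cb :* (x :* A) :+ cc :* (x :* A :* (x :* A))) :- ca :* (x :* A :* (x :* A))
           := x :* (con (+ 1) :+ x :* (cb :* A :- ca :* (A :* A) :+ cc :* (x :* (A :* A))))) ≋-refl X A ca cb cc ⟩
    X ⊛ (𝟙 ⊕ X ⊛ (cb ⊛ A ⊖ ca ⊛ (A ⊛ A) ⊕ cc ⊛ (X ⊛ (A ⊛ A)))) ∎)
    where
    open 𝕊
    open ≋-Reasoning
    ca cb cc : Series
    ca = const a
    cb = const b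
    cc = const c
    Y : Series
    Y = X ⊛ A
    Y₀≈0 : Y 0 ≈ 0#
    Y₀≈0 = X⊛-coeff₀ A
    H : Series
    H = compose h Y

    YH≋X : Y ⊛ H ≋ X
    YH≋X = begin
      Y ⊛ H                    ≈⟨ compose-xmul Y₀≈0 h ⟨
      compose (xmul h) Y       ≈⟨ compose-congʳ (xmul h) (xmul≋X⊛ A) ⟨
      compose (xmul h) (xmul A) ≈⟨ xA∘xh≋X ⟩
      X                        ∎

    h-expanded : h ⊕ cb ⊛ (X ⊛ h) ⊕ cc ⊛ (X ⊛ (X ⊛ h)) ≋ 𝟙 ⊕ ca ⊛ X
    h-expanded = begin
      h ⊕ cb ⊛ (X ⊛ h) ⊕ cc ⊛ (X ⊛ (X ⊛ h))
        ≈⟨ solve 4 (λ h x cb cc → h :+ cb :* (x :* h) :+ cc :* (x :* (x :* h))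
                   := h :* (con (+ 1) :+ cb :* x :+ cc :* (x :* (x :* con (+ 1))))) ≋-refl h X cb cc ⟩
      h ⊛ (𝟙 ⊕ cb ⊛ X ⊕ cc ⊛ pow X 2)
        ≈⟨ ⊛-congˡ (⊕-cong (⊕-congˡ {𝟙} (⊙≋const⊛ b X)) (⊙≋const⊛ c (pow X 2))) ⟨
      h ⊛ (𝟙 ⊕ b ⊙ X ⊕ c ⊙ pow X 2)
        ≈⟨ h-equation ⟩
      𝟙 ⊕ a ⊙ X
        ≈⟨ ⊕-congˡ (⊙≋const⊛ a X) ⟩
      𝟙 ⊕ ca ⊛ X ∎

    h∘Y : H ⊛ (𝟙 ⊕ cb ⊛ Y ⊕ cc ⊛ (Y ⊛ Y)) ≋ 𝟙 ⊕ ca ⊛ Y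
    h∘Y = begin
      H ⊛ (𝟙 ⊕ cb ⊛ Y ⊕ cc ⊛ (Y ⊛ Y))
        ≈⟨ solve 4 (λ H y cb cc → H :* (con (+ 1) :+ cb :* y :+ cc :* (y :* y))
                   := H :+ cb :* (y :* H) :+ cc :* (y :* (y :* H))) ≋-refl H Y cb cc ⟩
      H ⊕ cb ⊛ (Y ⊛ H) ⊕ cc ⊛ (Y ⊛ (Y ⊛ H))
        ≈⟨ ⊕-cong (⊕-congˡ (≋-trans (compose-const⊛ b (X ⊛ h) Y) (⊛-congˡ (compose-X⊛ Y₀≈0 h))))
              (≋-trans (compose-const⊛ c _ Y) (⊛-congˡ
                (≋-trans (compose-X⊛ Y₀≈0 (X ⊛ h)) (⊛-congˡ (compose-X⊛ Y₀≈0 h))))) ⟨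
      compose h Y ⊕ compose (cb ⊛ (X ⊛ h)) Y ⊕ compose (cc ⊛ (X ⊛ (X ⊛ h))) Y
        ≈⟨ ≋-trans (compose-⊕ _ _ Y) (⊕-congʳ (compose-⊕ _ _ Y)) ⟨
      compose (h ⊕ cb ⊛ (X ⊛ h) ⊕ cc ⊛ (X ⊛ (X ⊛ h))) Y
        ≈⟨ compose-congˡ Y h-expanded ⟩
      compose (𝟙 ⊕ ca ⊛ X) Y
        ≈⟨ ≋-trans (compose-⊕ 𝟙 _ Y) (⊕-cong (compose-𝟙 Y)
             (≋-trans (compose-const⊛ a X Y) (⊛-congˡ (compose-xmul Y₀≈0 𝟙)))) ⟩
      𝟙 ⊕ ca ⊛ (Y ⊛ compose 𝟙 Y)
        ≈⟨ ⊕-congˡ (⊛-congˡ (⊛-congˡ (compose-𝟙 Y))) ⟩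
      𝟙 ⊕ ca ⊛ (Y ⊛ 𝟙)
        ≈⟨ solve 2 (λ ca y → con (+ 1) :+ ca :* (y :* con (+ 1)) := con (+ 1) :+ ca :* y) ≋-refl ca Y ⟩
      𝟙 ⊕ ca ⊛ Y ∎

    substituted : Y ⊛ (𝟙 ⊕ ca ⊛ Y) ≋ X ⊛ (𝟙 ⊕ cb ⊛ Y ⊕ cc ⊛ (Y ⊛ Y))
    substituted = begin
      Y ⊛ (𝟙 ⊕ ca ⊛ Y)                              ≈⟨ ⊛-congˡ h∘Y ⟨
      Y ⊛ (H ⊛ (𝟙 ⊕ cb ⊛ Y ⊕ cc ⊛ (Y ⊛ Y)))         ≈⟨ ⊛-assoc Y H (𝟙 ⊕ cb ⊛ Y ⊕ cc ⊛ (Y ⊛ Y)) ⟨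
      Y ⊛ H ⊛ (𝟙 ⊕ cb ⊛ Y ⊕ cc ⊛ (Y ⊛ Y))           ≈⟨ ⊛-congʳ (𝟙 ⊕ cb ⊛ Y ⊕ cc ⊛ (Y ⊛ Y)) YH≋X ⟩
      X ⊛ (𝟙 ⊕ cb ⊛ Y ⊕ cc ⊛ (Y ⊛ Y))               ∎

  binomial-equation : ∀ {a b c A} →
    A ≋ 𝟙 ⊕ X ⊛ (const b ⊛ A ⊖ const a ⊛ (A ⊛ A) ⊕ const c ⊛ (X ⊛ (A ⊛ A))) →
    let B = binomialTransform A in
    (𝟙 ⊖ X) ⊛ B ≋ 𝟙 ⊕ X ⊛ (const b ⊛ B ⊖ const a ⊛ ((𝟙 ⊖ X) ⊛ (B ⊛ B)) ⊕ const c ⊛ (X ⊛ (B ⊛ B)))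
  binomial-equation {a} {b} {c} {A} A-equation = ⊛-cancelʳ {Q = u} u₀≈1 (begin
    u ⊛ B ⊛ u
      ≈⟨ ⊛-comm (u ⊛ B) u ⟩
    u ⊛ (u ⊛ T A)
      ≈⟨ ⊛-congˡ (⊛-congˡ (binomialTransform-cong A-equation)) ⟩
    u ⊛ (u ⊛ T (𝟙 ⊕ X ⊛ P))
      ≈⟨ ⊛-congˡ (≋-trans (⊛-congˡ (binomialTransform-⊕ 𝟙 (X ⊛ P)))
                                (⊛-distribˡ u (T 𝟙) (T (X ⊛ P)))) ⟩
    u ⊛ (u ⊛ T 𝟙 ⊕ u ⊛ T (X ⊛ P))
      ≈⟨ ⊛-congˡ (⊕-cong binomialTransform-𝟙 (binomialTransform-X⊛ P)) ⟩
    u ⊛ (𝟙 ⊕ X ⊛ T P)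
      ≈⟨ solve 3 (λ u x t → u :* (con (+ 1) :+ x :* t) := u :+ x :* (u :* t)) ≋-refl u X (T P) ⟩
    u ⊕ X ⊛ (u ⊛ T P)
      ≈⟨ ⊕-congˡ (⊛-congˡ transformed) ⟩
    u ⊕ X ⊛ (u ⊛ R)
      ≈⟨ solve 3 (λ u x r → u :+ x :* (u :* r) := (con (+ 1) :+ x :* r) :* u) ≋-refl u X R ⟩
    (𝟙 ⊕ X ⊛ R) ⊛ u ∎)
    where
    open 𝕊
    open ≋-Reasoning
    T : Series → Series
    T = binomialTransform
    u : Series
    u = 𝟙 ⊖ X
    B : Series
    B = T A
    ca cb cc : Series
    ca = const a
    cb = const b
    cc = const c
    P : Series
    P = cb ⊛ A ⊖ ca ⊛ (A ⊛ A) ⊕ cc ⊛ (X ⊛ (A ⊛ A))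
    R : Series
    R = cb ⊛ B ⊖ ca ⊛ (u ⊛ (B ⊛ B)) ⊕ cc ⊛ (X ⊛ (B ⊛ B))

    u₀≈1 : u 0 ≈ 1#
    u₀≈1 = trans (+-congˡ ε⁻¹≈ε) (+-identityʳ 1#)

    T[A⊛A] : T (A ⊛ A) ≋ u ⊛ B ⊛ B
    T[A⊛A] = binomialTransform-⊛ A A

    transformed : u ⊛ T P ≋ u ⊛ R
    transformed = begin
      u ⊛ T P
        ≈⟨ ⊛-congˡ (≋-trans (binomialTransform-⊕ _ _) (⊕-cong
             (≋-trans (binomialTransform-⊖ _ _) (⊕-cong (binomialTransform-const⊛ b A)
               (⊝-cong (≋-trans (binomialTransform-const⊛ a (A ⊛ A)) (⊛-congˡ T[A⊛A])))))
             (binomialTransform-const⊛ c (X ⊛ (A ⊛ A))))) ⟩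
      u ⊛ (cb ⊛ B ⊖ ca ⊛ (u ⊛ B ⊛ B) ⊕ cc ⊛ T (X ⊛ (A ⊛ A)))
        ≈⟨ solve 6 (λ u b t cb ca cc → u :* (cb :* b :- ca :* (u :* b :* b) :+ cc :* t)
            := u :* (cb :* b :- ca :* (u :* b :* b)) :+ cc :* (u :* t)) ≋-refl u B (T (X ⊛ (A ⊛ A))) cb ca cc ⟩
      u ⊛ (cb ⊛ B ⊖ ca ⊛ (u ⊛ B ⊛ B)) ⊕ cc ⊛ (u ⊛ T (X ⊛ (A ⊛ A)))
        ≈⟨ ⊕-congˡ (⊛-congˡ
          (≋-trans (binomialTransform-X⊛ (A ⊛ A)) (⊛-congˡ T[A⊛A]))) ⟩
      u ⊛ (cb ⊛ B ⊖ ca ⊛ (u ⊛ B ⊛ B)) ⊕ cc ⊛ (X ⊛ (u ⊛ B ⊛ B))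
        ≈⟨ solve 6 (λ u b x cb ca cc → u :* (cb :* b :- ca :* (u :* b :* b)) :+ cc :* (x :* (u :* b :* b))
           := u :* (cb :* b :- ca :* (u :* (b :* b)) :+ cc :* (x :* (b :* b)))) ≋-refl u B X cb ca cc ⟩
      u ⊛ R ∎

  binomialDenominator : Carrier → Carrier → Carrier → Series → Series
  binomialDenominator a b c B = 𝟙 ⊖ X ⊛ (const (b + 1#) ⊖ (const a ⊖ const (a + c) ⊛ X) ⊛ B)

  binomialDenominator-reciprocal : ∀ {a b c B} →
    (𝟙 ⊖ X) ⊛ B ≋ 𝟙 ⊕ X ⊛ (const b ⊛ B ⊖ const a ⊛ ((𝟙 ⊖ X) ⊛ (B ⊛ B)) ⊕ const c ⊛ (X ⊛ (B ⊛ B))) →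
    B ⊛ binomialDenominator a b c B ≋ 𝟙
  binomialDenominator-reciprocal {a} {b} {c} {B} B-equation = begin
    B ⊛ (𝟙 ⊖ X ⊛ (const (b + 1#) ⊖ (ca ⊖ const (a + c) ⊛ X) ⊛ B))
      ≈⟨ ⊛-congˡ (⊕-congˡ {𝟙} (⊝-cong (⊛-congˡ
           (⊕-cong (const-+ b 1#) (⊝-cong (⊛-congʳ B (⊕-congˡ {ca} (⊝-cong (⊛-congʳ X (const-+ a c)))))))))) ⟩
    B ⊛ (𝟙 ⊖ X ⊛ (cb ⊕ 𝟙 ⊖ (ca ⊖ (ca ⊕ cc) ⊛ X) ⊛ B))
      ≈⟨ solve 5 (λ x b ca cb cc → b :* (con (+ 1) :- x :* (cb :+ con (+ 1) :- (ca :- (ca :+ cc) :* x) :* b))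
           := (con (+ 1) :- x) :* b :- x :* (cb :* b :- ca :* ((con (+ 1) :- x) :* (b :* b)) :+ cc :* (x :* (b :* b))))
           ≋-refl X B ca cb cc ⟩
    (𝟙 ⊖ X) ⊛ B ⊖ X ⊛ R
      ≈⟨ ⊕-congʳ B-equation ⟩
    𝟙 ⊕ X ⊛ R ⊖ X ⊛ R
      ≈⟨ solve 2 (λ x r → con (+ 1) :+ x :* r :- x :* r := con (+ 1)) ≋-refl X R ⟩
    𝟙 ∎
    where
    open 𝕊
    open ≋-Reasoning
    ca cb cc : Series
    ca = const a
    cb = const b
    cc = const c
    R : Series
    R = cb ⊛ B ⊖ ca ⊛ ((𝟙 ⊖ X) ⊛ (B ⊛ B)) ⊕ cc ⊛ (X ⊛ (B ⊛ B))

  binomialDenominator-quadratic : ∀ {a b c B} → B ⊛ binomialDenominator a b c B ≋ 𝟙 →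
    let W = binomialDenominator a b c B in
    W ⊛ W ≋ (𝟙 ⊖ X ⊛ const (b + 1#)) ⊛ W ⊕ X ⊛ (const a ⊖ const (a + c) ⊛ X)
  binomialDenominator-quadratic {a} {b} {c} {B} BW≋𝟙 = reciprocal-quadratic BW≋𝟙
    (solve 5 (λ x b β α γ → con (+ 1) :- x :* (β :- (α :- γ :* x) :* b)
                         := (con (+ 1) :- x :* β) :+ x :* (α :- γ :* x) :* b)
      ≋-refl X B (const (b + 1#)) (const a) (const (a + c)))
    where open 𝕊

  -- W = V − (q − r) x, where V = 1 − r x − s x U is a root of Z² = (1 − r x) Z − s x because U V = 1.
  thronDenominator-quadratic : ∀ {q r s U β α γ} → IsThronTail r s U →
    (1# + 1#) * q - r ≈ β → q - r - s ≈ α → q * (q - r) ≈ γ →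
    let W = thronDenominator q s U in
    W ⊛ W ≋ (𝟙 ⊖ X ⊛ const β) ⊛ W ⊕ X ⊛ (const α ⊖ const γ ⊛ X)
  thronDenominator-quadratic {q} {r} {s} {U} {β} {α} {γ} U-tail β-def α-def γ-def = begin
    W ⊛ W
      ≈⟨ ⊛-cong W≋W′ W≋W′ ⟩
    W′ ⊛ W′
      ≈⟨ solve 5 (λ x v cq cr cs →
           (v :- x :* (cq :- cr)) :* (v :- x :* (cq :- cr))
           := (v :* v :- ((con (+ 1) :- x :* cr) :* v :+ :- (x :* cs)))
              :+ ((con (+ 1) :- x :* ((con (+ 1) :+ con (+ 1)) :* cq :- cr)) :* (v :- x :* (cq :- cr))
                  :+ x :* (cq :- cr :- cs :- cq :* (cq :- cr) :* x)))
           ≋-refl X V cq cr cs ⟩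
    (V ⊛ V ⊖ ((𝟙 ⊖ X ⊛ cr) ⊛ V ⊕ ⊝ (X ⊛ cs))) ⊕ RHS′
      ≈⟨ ⊕-congʳ (f≋g⇒f⊖g≋𝟎 V-quadratic) ⟩
    𝟎 ⊕ RHS′
      ≈⟨ (λ n → +-identityˡ (RHS′ n)) ⟩
    RHS′
      ≈⟨ ⊕-cong (⊛-cong (⊕-congˡ (⊝-cong (⊛-congˡ const-β))) W≋W′)
                (⊛-congˡ (⊕-cong const-α (⊝-cong (⊛-congʳ X const-γ)))) ⟨
    (𝟙 ⊖ X ⊛ const β) ⊛ W ⊕ X ⊛ (const α ⊖ const γ ⊛ X) ∎
    where
    open 𝕊
    open ≋-Reasoning
    cq cr cs : Series
    cq = const q
    cr = const r
    cs = const s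
    W V W′ RHS′ : Series
    W = thronDenominator q s U
    V = 𝟙 ⊖ X ⊛ (cr ⊕ cs ⊛ U)
    W′ = V ⊖ X ⊛ (cq ⊖ cr)
    RHS′ = (𝟙 ⊖ X ⊛ ((𝟙 ⊕ 𝟙) ⊛ cq ⊖ cr)) ⊛ W′ ⊕ X ⊛ (cq ⊖ cr ⊖ cs ⊖ cq ⊛ (cq ⊖ cr) ⊛ X)

    W≋W′ : W ≋ W′
    W≋W′ = ≋-trans (thronDenominator≋ q s U)
      (solve 5 (λ x u cq cr cs → con (+ 1) :- x :* (cq :+ cs :* u) := con (+ 1) :- x :* (cr :+ cs :* u) :- x :* (cq :- cr))
         ≋-refl X U cq cr cs)

    V-quadratic : V ⊛ V ≋ (𝟙 ⊖ X ⊛ cr) ⊛ V ⊕ ⊝ (X ⊛ cs)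
    V-quadratic = reciprocal-quadratic (≋-trans (⊛-congˡ (≋-sym (thronDenominator≋ r s U))) U-tail)
      (solve 4 (λ x u cr cs → con (+ 1) :- x :* (cr :+ cs :* u) := (con (+ 1) :- x :* cr) :+ (:- (x :* cs)) :* u)
         ≋-refl X U cr cs)

    const-β : const β ≋ (𝟙 ⊕ 𝟙) ⊛ cq ⊖ cr
    const-β = ≋-trans (const-cong (sym β-def))
      (≋-trans (const-+ _ _) (⊕-cong (≋-trans (const-* _ q) (⊛-congʳ cq (const-+ 1# 1#))) (const-neg r)))

    const-α : const α ≋ cq ⊖ cr ⊖ cs
    const-α = ≋-trans (const-cong (sym α-def))
      (≋-trans (const-+ _ _) (⊕-cong (≋-trans (const-+ q _) (⊕-congˡ (const-neg r))) (const-neg s)))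

    const-γ : const γ ≋ cq ⊛ (cq ⊖ cr)
    const-γ = ≋-trans (const-cong (sym γ-def))
      (≋-trans (const-* q _) (⊛-congˡ (≋-trans (const-+ q _) (⊕-congˡ (const-neg r)))))

  thronDenominator-coeff₀ : ∀ q s U → thronDenominator q s U 0 ≈ 1#
  thronDenominator-coeff₀ q s U = trans (thronDenominator≋ q s U 0) (𝟙⊖X⊛-coeff₀ (const q ⊕ const s ⊛ U))

  binomialDenominator-coeff₀ : ∀ a b c B → binomialDenominator a b c B 0 ≈ 1#
  binomialDenominator-coeff₀ a b c B = 𝟙⊖X⊛-coeff₀ (const (b + 1#) ⊖ (const a ⊖ const (a + c) ⊛ X) ⊛ B)

  2q-[-e]≈b+1 : ∀ {b e q} → (1# + 1#) * q ≈ b + 1# - e → (1# + 1#) * q - (- e) ≈ b + 1#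
  2q-[-e]≈b+1 {b} {e} {q} 2q≈b+1-e = begin
    (1# + 1#) * q - (- e)   ≈⟨ +-congʳ 2q≈b+1-e ⟩
    b + 1# - e - (- e)      ≈⟨ solve 2 (λ b e → b :+ con (+ 1) :- e :- (:- e) := b :+ con (+ 1)) refl b e ⟩
    b + 1#                  ∎
    where
    open 𝔽
    open ≈-Reasoning

  module _ (char0 : CharZero) where

    double-injective : ∀ {x y} → (1# + 1#) * x ≈ (1# + 1#) * y → x ≈ y
    double-injective {x} {y} 2x≈2y = begin
      x                       ≈⟨ *-identityˡ x ⟨
      1# * x                  ≈⟨ *-congʳ (trans (*-comm _ _) ½-inverse) ⟨
      (½ * (1# + 1#)) * x     ≈⟨ *-assoc _ _ _ ⟩
      ½ * ((1# + 1#) * x)     ≈⟨ *-congˡ 2x≈2y ⟩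
      ½ * ((1# + 1#) * y)     ≈⟨ *-assoc _ _ _ ⟨
      (½ * (1# + 1#)) * y     ≈⟨ *-congʳ (trans (*-comm _ _) ½-inverse) ⟩
      1# * y                  ≈⟨ *-identityˡ y ⟩
      y                       ∎
      where
      open ≈-Reasoning
      two≉0 : ¬ (1# + 1# ≈ 0#)
      two≉0 2≈0 = char0 1 (trans (+-congˡ (+-identityʳ 1#)) 2≈0)
      ½ : Carrier
      ½ = proj₁ (inverse (1# + 1#) two≉0)
      ½-inverse : (1# + 1#) * ½ ≈ 1#
      ½-inverse = proj₂ (inverse (1# + 1#) two≉0)

    q-[-e]-s≈a : ∀ {a b e q s} → (1# + 1#) * q ≈ b + 1# - e → (1# + 1#) * s ≈ - (1# + 1#) * a + b + 1# + e →
      q - (- e) - s ≈ a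
    q-[-e]-s≈a {a} {b} {e} {q} {s} 2q≈b+1-e 2s≈-2a+b+1+e = double-injective (begin
      (1# + 1#) * (q - (- e) - s)
        ≈⟨ solve 3 (λ q e s → con (+ 2) :* (q :- (:- e) :- s) := con (+ 2) :* q :+ con (+ 2) :* e :- con (+ 2) :* s)
             refl q e s ⟩
      (1# + 1#) * q + (1# + 1#) * e - (1# + 1#) * s
        ≈⟨ +-cong (+-congʳ 2q≈b+1-e) (-‿cong 2s≈-2a+b+1+e) ⟩
      b + 1# - e + (1# + 1#) * e - (- (1# + 1#) * a + b + 1# + e)
        ≈⟨ solve 3 (λ a b e → b :+ con (+ 1) :- e :+ con (+ 2) :* e :- ((:- con (+ 2)) :* a :+ b :+ con (+ 1) :+ e)
                             := con (+ 2) :* a) refl a b e ⟩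
      (1# + 1#) * a ∎)
      where
      open 𝔽
      open ≈-Reasoning

    q[q-[-e]]≈a+c : ∀ {a b c e q} → e * e ≈ (b + 1#) * (b + 1#) - (1# + 1# + 1# + 1#) * (c + a) →
      (1# + 1#) * q ≈ b + 1# - e → q * (q - (- e)) ≈ a + c
    q[q-[-e]]≈a+c {a} {b} {c} {e} {q} e²≈disc 2q≈b+1-e = double-injective (double-injective (begin
      (1# + 1#) * ((1# + 1#) * (q * (q - (- e))))
        ≈⟨ solve 2 (λ q e → con (+ 2) :* (con (+ 2) :* (q :* (q :- (:- e))))
                           := con (+ 2) :* q :* (con (+ 2) :* q :+ con (+ 2) :* e)) refl q e ⟩
      (1# + 1#) * q * ((1# + 1#) * q + (1# + 1#) * e)
        ≈⟨ *-cong 2q≈b+1-e (+-congʳ 2q≈b+1-e) ⟩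
      (b + 1# - e) * (b + 1# - e + (1# + 1#) * e)
        ≈⟨ solve 2 (λ b e → (b :+ con (+ 1) :- e) :* (b :+ con (+ 1) :- e :+ con (+ 2) :* e)
             := (b :+ con (+ 1)) :* (b :+ con (+ 1)) :- e :* e) refl b e ⟩
      (b + 1#) * (b + 1#) - e * e
        ≈⟨ +-congˡ (-‿cong e²≈disc) ⟩
      (b + 1#) * (b + 1#) - ((b + 1#) * (b + 1#) - (1# + 1# + 1# + 1#) * (c + a))
        ≈⟨ solve 3 (λ a b c → (b :+ con (+ 1)) :* (b :+ con (+ 1))
                               :- ((b :+ con (+ 1)) :* (b :+ con (+ 1)) :- con (+ 4) :* (c :+ a))
             := con (+ 2) :* (con (+ 2) :* (a :+ c))) refl a b c ⟩
      (1# + 1#) * ((1# + 1#) * (a + c)) ∎))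
      where
      open 𝔽
      open ≈-Reasoning

proposition6 : {c₀ ℓ : Level} (L : Field c₀ ℓ) →
    let open Field L in
    let open PowerSeries L in
    CharZero →
    (a b c e : Carrier) →
    e * e ≈ (b + 1#) * (b + 1#) - (1# + 1# + 1# + 1#) * (c + a) →
    (h : Series) →
    h ⊛ (𝟙 ⊕ b ⊙ X ⊕ c ⊙ pow X 2) ≋ 𝟙 ⊕ a ⊙ X →
    (A : Series) →
    IsRevertTransform h A →
    (q s : Carrier) →
    (1# + 1#) * q ≈ b + 1# - e →
    (1# + 1#) * s ≈ - (1# + 1# ) * a + b + 1# + e →
    IsThronCF q (- e) s (binomialTransform A)
proposition6 L char0 a b c e e²≈disc h h-equation A (_ , _ , _ , xA∘xh≋X , _) q s 2q≈b+1-e 2s≈-2a+b+1+e =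
  U , U-tail , ≋-trans (⊛-congˡ denominators-agree) B-reciprocal
  where
  open Field L
  open PowerSeries L
  open FormalPowerSeries L
  B : Series
  B = binomialTransform A
  U : Series
  U = proj₁ (thronTail-exists (- e) s)
  U-tail : IsThronTail (- e) s U
  U-tail = proj₂ (thronTail-exists (- e) s)

  B-reciprocal : B ⊛ binomialDenominator a b c B ≋ 𝟙
  B-reciprocal = binomialDenominator-reciprocal (binomial-equation (revert-equation h-equation xA∘xh≋X))

  denominators-agree : thronDenominator q s U ≋ binomialDenominator a b c B
  denominators-agree = quadratic-root-unique
    (𝟙⊖X⊛-coeff₀ (const (b + 1#))) (thronDenominator-coeff₀ q s U) (binomialDenominator-coeff₀ a b c B)
    (thronDenominator-quadratic U-tail (2q-[-e]≈b+1 2q≈b+1-e)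
      (q-[-e]-s≈a char0 2q≈b+1-e 2s≈-2a+b+1+e) (q[q-[-e]]≈a+c char0 e²≈disc 2q≈b+1-e))
    (binomialDenominator-quadratic B-reciprocal)
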